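{- Fix $\theta>0$ and let $\beta_1,\beta_2,\ldots$ be independent Bernoulli random variables with $\Pr(\beta_j=1)=\theta/(\theta+j-1)$. For positive integers $k,n$ let $c^{(n)}_k$ be the number of $k$-spacings in the word $1\beta_2\beta_3\cdots\beta_n1$, and for $k\ge1$, $m\ge0$ let $Z_{k,m}$ be the number of $k$-spacings in the infinite word $\beta_{m+1}\beta_{m+2}\cdots$. Let $L_n=\min\{j\ge1:\beta_{n-j+1}=1\}$ and $R_n=\min\{j\ge1:\beta_{n+j}=1\}$. Then for all positive integers $k$ and $n$, \[Z_{k,0}-Z_{k,n}-\mathbb{1}\{L_n+R_n=k+1\}\le c^{(n)}_k\le Z_{k,0}+\mathbb{1}\{L_n=k\}.\]
   Context: In a word of zeros and ones $x_1x_2\cdots$, a $k$-spacing occurs starting at position $\ell-k$ and ending at position $\ell$ if $x_{\ell-k}=x_\ell=1$ and $x_j=0$ for $\ell-k+1\le j\le \ell-1$. -}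

module Defs where

open import Data.Nat using (ℕ; zero; suc; _+_; _∸_; _≤_; _<_; _≡ᵇ_; _≤ᵇ_)
open import Data.Bool using (Bool; true; false; _∧_; if_then_else_)
open import Relation.Binary.PropositionalEquality using (_≡_)

-- A word of zeros and ones is a function from positions to Bool
-- (true = 1). Positions are 1-based; position 0 is never used.
Word : Set
Word = ℕ → Bool

noneIn : Word → ℕ → ℕ → Bool
noneIn w a zero    = true
noneIn w a (suc l) = if w a then false else noneIn w (suc a) l

spacingAt : Word → ℕ → ℕ → Bool
spacingAt w k s = w s ∧ w (s + k) ∧ noneIn w (suc s) (k ∸ 1)

countSp : Word → ℕ → ℕ → ℕ → ℕ
countSp w k a zero    = 0
countSp w k a (suc l) = (if spacingAt w k a then 1 else 0) + countSp w k (suc a) l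

𝟙 : Bool → ℕ
𝟙 true  = 1
𝟙 false = 0

-- The finite word 1 β_2 β_3 ⋯ β_n 1 (positions 1 .. n+1)
finWord : Word → ℕ → Word
finWord β n zero       = false
finWord β n (suc zero) = true
finWord β n (suc (suc i)) =
  if suc (suc i) ≤ᵇ n then β (suc (suc i))
  else (if suc (suc i) ≡ᵇ suc n then true else false)

-- c^{(n)}_k : k-spacings in 1 β_2 ⋯ β_n 1 (start s with 1 ≤ s and s + k ≤ n + 1)
c : Word → ℕ → ℕ → ℕ
c β n k = countSp (finWord β n) k 1 (suc n ∸ k)

-- Z_{k,m} computed with cutoff N: k-spacings of β_{m+1} β_{m+2} ⋯ starting
-- at positions s with m+1 ≤ s < N.  Equals the true count whenever no
-- k-spacing of β starts at a position ≥ N.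
Zcut : Word → ℕ → ℕ → ℕ → ℕ
Zcut β N k m = countSp β k (suc m) (N ∸ suc m)

IsL : Word → ℕ → ℕ → Set
IsL β n L = 1 ≤ L × L ≤ n × β (suc n ∸ L) ≡ true
            × (∀ j → 1 ≤ j → j < L → β (suc n ∸ j) ≡ false)
  where open import Data.Product using (_×_)

IsR : Word → ℕ → ℕ → Set
IsR β n R = 1 ≤ R × β (n + R) ≡ true × (∀ j → 1 ≤ j → j < R → β (n + j) ≡ false)
  where open import Data.Product using (_×_)

-- A k-spacing of the finite word 1 β₂ ⋯ βₙ 1 either ends at a position ≤ n, where the word agrees
-- with β, or ends at the appended 1 at position n + 1; in the latter case it starts at the last 1
-- of β₁ ⋯ βₙ, i.e. at n + 1 − L, which forces L = k.  Conversely a k-spacing of β starting at a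
-- position s ≤ n either ends at a position ≤ n, where it is a spacing of the finite word, or
-- straddles n; then s is the last 1 up to n and s + k the first 1 after n, so s = n + 1 − L and
-- s + k = n + R, forcing L + R = k + 1.  Spacings of β starting after n are counted by Z_{k,n}.
module Submission where

open import Defs
open import Data.Nat using (ℕ; _+_; _≤_; _≥_; _≡ᵇ_)
open import Data.Bool using (Bool; true; false)
open import Relation.Binary.PropositionalEquality using (_≡_)
open import Data.Product using (_×_)

open import Data.Nat using (zero; suc; _∸_; _<_; _≤ᵇ_; z≤n; z<s; s≤s; s≤s⁻¹; _≤?_)
open import Data.Nat.Properties
open import Data.Bool using (T; if_then_else_)
open import Data.Bool.Properties using (T-≡)
open import Data.Product using (_,_)
open import Data.Sum using (_⊎_; inj₁; inj₂)
open import Data.Empty using (⊥; ⊥-elim)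
open import Function.Bundles using (Equivalence)
open import Relation.Binary.Definitions using (tri<; tri≈; tri>)
open import Relation.Binary.PropositionalEquality
  using (refl; sym; trans; cong; subst; module ≡-Reasoning)
open import Relation.Nullary using (yes; no)

≡⇒≡ᵇ-true : ∀ {m n} → m ≡ n → (m ≡ᵇ n) ≡ true
≡⇒≡ᵇ-true {m} {n} m≡n = Equivalence.to T-≡ (≡⇒≡ᵇ m n m≡n)

true≡false-elim : ∀ {b} → b ≡ true → b ≡ false → ⊥
true≡false-elim refl ()

<-+-suc : ∀ {j} a l → j < suc a + l → j < a + suc l
<-+-suc {j} a l = subst (j <_) (sym (+-suc a l))

range-tail : ∀ {P : ℕ → Set} a l → (∀ s → a ≤ s → s < a + suc l → P s) →
  ∀ s → suc a ≤ s → s < suc a + l → P s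
range-tail a l p s a<s s< = p s (<⇒≤ a<s) (<-+-suc a l s<)

0<m≤o∸n⇒m+n≤o : ∀ {m n o} → 1 ≤ m → m ≤ o ∸ n → m + n ≤ o
0<m≤o∸n⇒m+n≤o {m} {n} {o} 1≤m m≤o∸n with ≤-total n o
... | inj₁ n≤o = m≤o∸n⇒m+n≤o m n≤o m≤o∸n
... | inj₂ o≤n rewrite m≤n⇒m∸n≡0 o≤n = ⊥-elim (<⇒≱ 1≤m m≤o∸n)

m+n≡o⇒m≡o∸n : ∀ {m n o} → m + n ≡ o → m ≡ o ∸ n
m+n≡o⇒m≡o∸n {m} {n} refl = sym (m+n∸n≡m m n)

noneIn⇒false : ∀ w a l → noneIn w a l ≡ true → ∀ j → a ≤ j → j < a + l → w j ≡ false
noneIn⇒false w a zero    _    j a≤j j<a+0 = ⊥-elim (<⇒≱ j<a+0 (subst (_≤ j) (sym (+-identityʳ a)) a≤j))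
noneIn⇒false w a (suc l) none j a≤j j<a+l with w a in wa | m≤n⇒m<n∨m≡n a≤j
... | false | inj₂ refl = wa
... | false | inj₁ a<j = noneIn⇒false w (suc a) l none j a<j (subst (j <_) (+-suc a l) j<a+l)

noneIn-cong : ∀ w v a l → (∀ j → a ≤ j → j < a + l → w j ≡ v j) → noneIn w a l ≡ noneIn v a l
noneIn-cong w v a zero    _  = refl
noneIn-cong w v a (suc l) eq
  rewrite eq a ≤-refl (<-+-suc a l (s≤s (m≤m+n a l)))
        | noneIn-cong w v (suc a) l (λ j a<j j< → eq j (<⇒≤ a<j) (<-+-suc a l j<))
  = refl

spacingAt-cong : ∀ w v k s → (∀ j → s ≤ j → j ≤ s + suc k → w j ≡ v j) →
  spacingAt w (suc k) s ≡ spacingAt v (suc k) s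
spacingAt-cong w v k s eq
  rewrite eq s ≤-refl (m≤m+n s (suc k))
        | eq (s + suc k) (m≤m+n s (suc k)) ≤-refl
        | noneIn-cong w v (suc s) k
            (λ j s<j j< → eq j (<⇒≤ s<j) (≤-trans (<⇒≤ j<) (≤-reflexive (sym (+-suc s k)))))
  = refl

spacingAt⇒ : ∀ w k s → spacingAt w (suc k) s ≡ true →
  w s ≡ true × w (s + suc k) ≡ true × (∀ j → s < j → j < s + suc k → w j ≡ false)
spacingAt⇒ w k s sp with w s | w (s + suc k) | noneIn w (suc s) k in gap
spacingAt⇒ w k s sp | true | true | true =
  refl , refl , λ j s<j j< → noneIn⇒false w (suc s) k gap j s<j (subst (j <_) (+-suc s k) j<)
spacingAt⇒ w k s () | true  | true  | false
spacingAt⇒ w k s () | true  | false | _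
spacingAt⇒ w k s () | false | _     | _

spacingAt-falseʳ : ∀ w k s → w (s + k) ≡ false → spacingAt w k s ≡ false
spacingAt-falseʳ w k s end with w s
... | false = refl
... | true rewrite end = refl

countSp-+ : ∀ w k a l₁ l₂ → countSp w k a (l₁ + l₂) ≡ countSp w k a l₁ + countSp w k (a + l₁) l₂
countSp-+ w k a zero     l₂ rewrite +-identityʳ a = refl
countSp-+ w k a (suc l₁) l₂ rewrite countSp-+ w k (suc a) l₁ l₂ | +-suc a l₁ =
  sym (+-assoc (if spacingAt w k a then 1 else 0) _ _)

countSp-none : ∀ w k a l → (∀ s → a ≤ s → spacingAt w k s ≡ false) → countSp w k a l ≡ 0
countSp-none w k a zero    _    = refl
countSp-none w k a (suc l) none rewrite none a ≤-refl =
  countSp-none w k (suc a) l (λ s a<s → none s (<⇒≤ a<s))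

countSp-≤-exhausted : ∀ w k a l m → (∀ s → a + m ≤ s → spacingAt w k s ≡ false) →
  countSp w k a l ≤ countSp w k a m
countSp-≤-exhausted w k a l m none with ≤-total l m
... | inj₁ l≤m rewrite sym (m+[n∸m]≡n l≤m) | countSp-+ w k a l (m ∸ l) = m≤m+n _ _
... | inj₂ m≤l rewrite sym (m+[n∸m]≡n m≤l) | countSp-+ w k a m (l ∸ m)
                     | countSp-none w k (a + m) (l ∸ m) none = ≤-reflexive (+-identityʳ _)

-- The exception e is hit at most once, so the tail beyond it is compared with budget b = false.
countSp-≤-except : ∀ w v k a l e b →
  (∀ s → a ≤ s → s < a + l → spacingAt w k s ≡ true →
     spacingAt v k s ≡ true ⊎ (s ≡ e × b ≡ true)) →
  countSp w k a l ≤ countSp v k a l + 𝟙 b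
countSp-≤-except w v k a zero    e b _    = z≤n
countSp-≤-except w v k a (suc l) e b step with spacingAt w k a in spw
... | false = ≤-trans (countSp-≤-except w v k (suc a) l e b (range-tail a l step))
                      (+-monoˡ-≤ (𝟙 b) (m≤n+m _ _))
... | true with step a ≤-refl (<-+-suc a l (s≤s (m≤m+n a l))) spw
...   | inj₁ spv rewrite spv = s≤s (countSp-≤-except w v k (suc a) l e b (range-tail a l step))
...   | inj₂ (refl , refl) =
  ≤-trans (s≤s (≤-trans (countSp-≤-except w v k (suc a) l a false pastException)
                        (≤-reflexive (+-identityʳ _))))
          (≤-trans (s≤s (m≤n+m _ _)) (≤-reflexive (+-comm 1 _)))
  where
  pastException : ∀ s → suc a ≤ s → s < suc a + l → spacingAt w k s ≡ true →
    spacingAt v k s ≡ true ⊎ (s ≡ a × false ≡ true)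
  pastException s a<s s< sp with range-tail a l step s a<s s< sp
  ... | inj₁ spv         = inj₁ spv
  ... | inj₂ (refl , _) = ⊥-elim (<-irrefl refl a<s)

finWord-agrees : ∀ β n → β 1 ≡ true → ∀ i → 1 ≤ i → i ≤ n → finWord β n i ≡ β i
finWord-agrees β n β₁ (suc zero)    _ _   = sym β₁
finWord-agrees β n β₁ (suc (suc i)) _ i≤n with suc (suc i) ≤ᵇ n in le
... | true  = refl
... | false = ⊥-elim (subst T le (≤⇒≤ᵇ i≤n))

finWord-beyond : ∀ β n i → suc (suc n) ≤ i → finWord β n i ≡ false
finWord-beyond β n (suc (suc i)) (s≤s (s≤s n≤i)) with suc (suc i) ≤ᵇ n in le
... | true = ⊥-elim (<⇒≱ (≤ᵇ⇒≤ (suc (suc i)) n (subst T (sym le) _)) (≤-trans n≤i (n≤1+n i)))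
... | false with suc (suc i) ≡ᵇ suc n in eq
...   | true  = ⊥-elim (<-irrefl (sym (≡ᵇ⇒≡ (suc (suc i)) (suc n) (subst T (sym eq) _))) (s≤s (s≤s n≤i)))
...   | false = refl

finWord-no-spacing-beyond : ∀ β n k s → suc n < s + k → spacingAt (finWord β n) k s ≡ false
finWord-no-spacing-beyond β n k s n<s+k =
  spacingAt-falseʳ (finWord β n) k s (finWord-beyond β n (s + k) n<s+k)

IsL-last : ∀ {β n L s} → IsL β n L → s ≤ n → β s ≡ true →
  (∀ j → s < j → j ≤ n → β j ≡ false) → s + L ≡ suc n
IsL-last {β} {n} {L} {s} (1≤L , L≤n , βp , beforeL) s≤n βs afterS with <-cmp (s + L) (suc n)
... | tri≈ _ eq _ = eq
... | tri< s+L<n+1 _ _ =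
  ⊥-elim (true≡false-elim βp (afterS (suc n ∸ L) (m+n≤o⇒m≤o∸n (suc s) s+L<n+1) (∸-monoʳ-≤ (suc n) 1≤L)))
... | tri> _ _ n+1<s+L =
  ⊥-elim (true≡false-elim βs (subst (λ i → β i ≡ false) (m∸[m∸n]≡n s≤n+1) (beforeL j 1≤j j<L)))
  where
  s≤n+1 : s ≤ suc n
  s≤n+1 = m≤n⇒m≤1+n s≤n
  j = suc n ∸ s
  1≤j : 1 ≤ j
  1≤j = m<n⇒0<n∸m (s≤s s≤n)
  j<L : j < L
  j<L = +-cancelˡ-< s j L (subst (_< s + L) (sym (m+[n∸m]≡n s≤n+1)) n+1<s+L)

IsR-first : ∀ {β n R t} → IsR β n R → n < t → β t ≡ true →
  (∀ j → n < j → j < t → β j ≡ false) → t ≡ n + R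
IsR-first {β} {n} {R} {t} (1≤R , βq , beforeR) n<t βt betweenNT with <-cmp t (n + R)
... | tri≈ _ eq _ = eq
... | tri< t<n+R _ _ =
  ⊥-elim (true≡false-elim βt (subst (λ i → β i ≡ false) (m+[n∸m]≡n (<⇒≤ n<t)) (beforeR j 1≤j j<R)))
  where
  j = t ∸ n
  1≤j : 1 ≤ j
  1≤j = m<n⇒0<n∸m n<t
  j<R : j < R
  j<R = +-cancelˡ-< n j R (subst (_< n + R) (sym (m+[n∸m]≡n (<⇒≤ n<t))) t<n+R)
... | tri> _ _ n+R<t =
  ⊥-elim (true≡false-elim βq (betweenNT (n + R) (subst (_≤ n + R) (+-comm n 1) (+-monoʳ-≤ n 1≤R)) n+R<t))

module _ {β : Word} {n L : ℕ} (β₁ : β 1 ≡ true) (isL : IsL β n L) where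

  finWord-agrees-on : ∀ {s} k → 1 ≤ s → s + suc k ≤ n →
    ∀ j → s ≤ j → j ≤ s + suc k → finWord β n j ≡ β j
  finWord-agrees-on k 1≤s s+K≤n j s≤j j≤s+K =
    finWord-agrees β n β₁ j (≤-trans 1≤s s≤j) (≤-trans j≤s+K s+K≤n)

  finWord-spacing⇒ : ∀ k s → 1 ≤ s → s + suc k ≤ suc n → spacingAt (finWord β n) (suc k) s ≡ true →
    spacingAt β (suc k) s ≡ true ⊎ (s ≡ suc n ∸ L × (L ≡ᵇ suc k) ≡ true)
  finWord-spacing⇒ k s 1≤s s+K≤n+1 sp with m≤n⇒m<n∨m≡n s+K≤n+1
  ... | inj₁ (s≤s s+K≤n) =
    inj₁ (trans (sym (spacingAt-cong (finWord β n) β k s (finWord-agrees-on k 1≤s s+K≤n))) sp)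
  ... | inj₂ s+K≡n+1 =
    inj₂ (m+n≡o⇒m≡o∸n s+L≡n+1 , ≡⇒≡ᵇ-true (+-cancelˡ-≡ s L (suc k) (trans s+L≡n+1 (sym s+K≡n+1))))
    where
    s≤n : s ≤ n
    s≤n = s≤s⁻¹ (subst (suc s ≤_) s+K≡n+1 (m<m+n s z<s))
    agree : ∀ j → 1 ≤ j → j ≤ n → finWord β n j ≡ β j
    agree = finWord-agrees β n β₁
    s+L≡n+1 : s + L ≡ suc n
    s+L≡n+1 with spacingAt⇒ (finWord β n) k s sp
    ... | start , _ , gap = IsL-last isL s≤n (trans (sym (agree s 1≤s s≤n)) start)
      λ j s<j j≤n → trans (sym (agree j (≤-trans 1≤s (<⇒≤ s<j)) j≤n))
                          (gap j s<j (subst (j <_) (sym s+K≡n+1) (s≤s j≤n)))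

  β-spacing⇒ : ∀ {R} → IsR β n R → ∀ k s → 1 ≤ s → s ≤ n → spacingAt β (suc k) s ≡ true →
    spacingAt (finWord β n) (suc k) s ≡ true ⊎ (s ≡ suc n ∸ L × (L + R ≡ᵇ suc k + 1) ≡ true)
  β-spacing⇒ {R} isR k s 1≤s s≤n sp with s + suc k ≤? n
  ... | yes s+K≤n = inj₁ (trans (spacingAt-cong (finWord β n) β k s (finWord-agrees-on k 1≤s s+K≤n)) sp)
  ... | no s+K≰n with spacingAt⇒ β k s sp
  ...   | start , end , gap = inj₂ (m+n≡o⇒m≡o∸n s+L≡n+1 , ≡⇒≡ᵇ-true (+-cancelˡ-≡ s (L + R) (suc k + 1) s+[L+R]≡s+[K+1]))
    where
    n<s+K : n < s + suc k
    n<s+K = ≰⇒> s+K≰n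
    s+L≡n+1 : s + L ≡ suc n
    s+L≡n+1 = IsL-last isL s≤n start (λ j s<j j≤n → gap j s<j (≤-<-trans j≤n n<s+K))
    s+K≡n+R : s + suc k ≡ n + R
    s+K≡n+R = IsR-first isR n<s+K end (λ j n<j j<s+K → gap j (≤-<-trans s≤n n<j) j<s+K)
    s+[L+R]≡s+[K+1] : s + (L + R) ≡ s + (suc k + 1)
    s+[L+R]≡s+[K+1] = begin
      s + (L + R)     ≡⟨ sym (+-assoc s L R) ⟩
      s + L + R       ≡⟨ cong (_+ R) s+L≡n+1 ⟩
      suc (n + R)     ≡⟨ cong suc (sym s+K≡n+R) ⟩
      suc (s + suc k) ≡⟨ +-comm 1 (s + suc k) ⟩
      s + suc k + 1   ≡⟨ +-assoc s (suc k) 1 ⟩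
      s + (suc k + 1) ∎
      where open ≡-Reasoning

  c-≤-Zcut+𝟙[L≡k] : ∀ k N → (∀ s → s ≥ N → spacingAt β (suc k) s ≡ false) →
    c β n (suc k) ≤ Zcut β N (suc k) 0 + 𝟙 (L ≡ᵇ suc k)
  c-≤-Zcut+𝟙[L≡k] k N noneFromN = ≤-trans
    (countSp-≤-except (finWord β n) β (suc k) 1 (suc n ∸ suc k) (suc n ∸ L) (L ≡ᵇ suc k)
       λ s 1≤s s< → finWord-spacing⇒ k s 1≤s (0<m≤o∸n⇒m+n≤o 1≤s (s≤s⁻¹ s<)))
    (+-monoˡ-≤ (𝟙 (L ≡ᵇ suc k)) (countSp-≤-exhausted β (suc k) 1 (suc n ∸ suc k) (N ∸ 1)
       λ s N≤s → noneFromN s (≤-trans (m≤n+m∸n N 1) N≤s)))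

  Zcut-≤-c+Zcut+𝟙[L+R≡k+1] : ∀ {R} → IsR β n R → ∀ k N → (∀ s → s ≥ N → spacingAt β (suc k) s ≡ false) →
    Zcut β N (suc k) 0 ≤ c β n (suc k) + Zcut β N (suc k) n + 𝟙 (L + R ≡ᵇ suc k + 1)
  Zcut-≤-c+Zcut+𝟙[L+R≡k+1] {R} isR k N noneFromN = begin
    countSp β K 1 (N ∸ 1)
      ≤⟨ countSp-≤-exhausted β K 1 (N ∸ 1) (n + (N ∸ suc n))
           (λ s N≤s → noneFromN s (≤-trans (m≤n+m∸n N (suc n)) N≤s)) ⟩
    countSp β K 1 (n + (N ∸ suc n))
      ≡⟨ countSp-+ β K 1 n (N ∸ suc n) ⟩
    countSp β K 1 n + Zₙ
      ≤⟨ +-monoˡ-≤ Zₙ (countSp-≤-except β (finWord β n) K 1 n (suc n ∸ L) b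
           (λ s 1≤s s≤n → β-spacing⇒ isR k s 1≤s (s≤s⁻¹ s≤n))) ⟩
    countSp (finWord β n) K 1 n + 𝟙 b + Zₙ
      ≤⟨ +-monoˡ-≤ Zₙ (+-monoˡ-≤ (𝟙 b) (countSp-≤-exhausted (finWord β n) K 1 n (suc n ∸ K)
           (λ s le → finWord-no-spacing-beyond β n K s
              (≤-trans (s≤s (subst (suc n ≤_) (+-comm K _) (m≤n+m∸n (suc n) K))) (+-monoˡ-≤ K le))))) ⟩
    c β n K + 𝟙 b + Zₙ
      ≡⟨ +-assoc (c β n K) (𝟙 b) Zₙ ⟩
    c β n K + (𝟙 b + Zₙ)
      ≡⟨ cong (c β n K +_) (+-comm (𝟙 b) Zₙ) ⟩
    c β n K + (Zₙ + 𝟙 b)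
      ≡⟨ sym (+-assoc (c β n K) Zₙ (𝟙 b)) ⟩
    c β n K + Zₙ + 𝟙 b ∎
    where
    open ≤-Reasoning
    K = suc k
    Zₙ = Zcut β N K n
    b = L + R ≡ᵇ K + 1

lemma5p2 : (β : ℕ → Bool) → β 1 ≡ true →
    (k n : ℕ) → 1 ≤ k → 1 ≤ n →
    (N : ℕ) → (∀ s → s ≥ N → spacingAt β k s ≡ false) →
    (L R : ℕ) → IsL β n L → IsR β n R →
    (Zcut β N k 0 ≤ c β n k + Zcut β N k n + 𝟙 (L + R ≡ᵇ k + 1))
    × (c β n k ≤ Zcut β N k 0 + 𝟙 (L ≡ᵇ k))
lemma5p2 β β₁ (suc k) n _ _ N noneFromN L R isL isR =
  Zcut-≤-c+Zcut+𝟙[L+R≡k+1] β₁ isL isR k N noneFromN , c-≤-Zcut+𝟙[L≡k] β₁ isL k N noneFromN
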